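{- Let $\mathbf{P}$ be a meet-semilattice with top element $1$, regarded as a partially ordered monoid with multiplication $\wedge$ and unit $1$, and let $\mathbf{L}$ be a join-completion of $\langle P,\le\rangle$, regarded as a subset of $\mathcal{L}(\mathbf{P})$ containing $P$. The following statements are equivalent: (i) $\mathbf{L}$ is a Heyting algebra with respect to its lattice reduct (i.e., it can be made into one by adding a Heyting implication); (ii) for all $a\in P$ and $b\in L$, $a\to_{\mathcal{L}(\mathbf{P})} b\in L$; (iii) $L$ is a nucleus-system of $\langle\mathcal{L}(\mathbf{P}),\cap,\cup,\cap,\to_{\mathcal{L}(\mathbf{P})},P\rangle$; (iv) the closure operator $\gamma_L$ associated with $L$ is a nucleus on $\mathcal{L}(\mathbf{P})$ (with multiplication $\cap$). Furthermore, whenever these conditions hold, the Heyting algebra structure on $\mathbf{L}$ is uniquely determined and the inclusion map $\mathbf{P}\hookrightarrow\mathbf{L}$ preserves all existing meets and all existing residuals (relative pseudocomplements).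
   Context: For a poset $\mathbf{P}$, $\mathcal{L}(\mathbf{P})$ is the complete lattice of order-ideals (down-sets) under inclusion, each $p\in P$ being identified with ${\downarrow}p$. A join-completion of $\langle P,\le\rangle$ is a complete lattice containing $P$ with the same order on $P$ in which every element is a join of elements of $P$; every such is isomorphic (fixing $P$) to a subset of $\mathcal{L}(\mathbf{P})$ containing $P$. A Heyting algebra here is a lattice in which for all $x,z$ the relative pseudocomplement $x\to z=\max\{y\mid x\wedge y\le z\}$ exists. In $\mathcal{L}(\mathbf{P})$, $X\to Y=\{z\in P\mid {\downarrow}z\cap X\subseteq Y\}$. A closure system of a poset $\mathbf{K}$ is a subset $C$ such that $\gamma_C(x)=\min\{c\in C\mid x\le c\}$ exists for all $x$. A nucleus (with respect to a multiplication $\cdot$) is a closure operator $\gamma$ with $\gamma(a)\cdot\gamma(b)\le\gamma(a\cdot b)$; a nucleus-system of an algebra with multiplication $\cdot$ and residual(s) is a closure system $C$ such that the residuals $x\backslash a$, $a/x$ (here: $x\to a$) lie in $C$ for all $x$ in the algebra and $a\in C$. -}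

module Defs where

open import Level using (Level; _⊔_; suc; Lift; lift)
open import Data.Product using (Σ; ∃; _×_; _,_)
open import Data.Sum using (_⊎_)
open import Function.Bundles using (_⇔_)
open import Relation.Binary.Lattice.Bundles using (BoundedMeetSemilattice)

module _ {c ℓ₁ ℓ₂ : Level} (P : BoundedMeetSemilattice c ℓ₁ ℓ₂) where
  open BoundedMeetSemilattice P

  lvl : Level
  lvl = c ⊔ ℓ₂

  record DownSet : Set (suc lvl) where
    constructor mkDown
    field
      mem  : Carrier → Set lvl
      down : ∀ {x y} → y ≤ x → mem x → mem y
  open DownSet public

  _⊆_ : DownSet → DownSet → Set lvl
  X ⊆ Y = ∀ {x} → mem X x → mem Y x

  _≐_ : DownSet → DownSet → Set lvl
  X ≐ Y = (X ⊆ Y) × (Y ⊆ X)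

  -- the principal down-set ↓p (identification of p ∈ P with ↓p)
  ↓ : Carrier → DownSet
  ↓ p = mkDown (λ z → Lift c (z ≤ p))
               (λ { y≤x (lift x≤p) → lift (trans y≤x x≤p) })

  _∩_ : DownSet → DownSet → DownSet
  X ∩ Y = mkDown (λ z → mem X z × mem Y z)
                 (λ { y≤x (a , b) → down X y≤x a , down Y y≤x b })

  _⇒_ : DownSet → DownSet → DownSet
  X ⇒ Y = mkDown (λ z → ∀ {w} → w ≤ z → mem X w → mem Y w)
                 (λ y≤x h w≤y → h (trans w≤y y≤x))

  module _ {ℓL : Level} (L : DownSet → Set ℓL) where

    IsLubIn : ∀ {t} → (DownSet → Set t) → DownSet → Set (suc lvl ⊔ ℓL ⊔ t)
    IsLubIn S u = L u × (∀ X → S X → X ⊆ u)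
                      × (∀ v → L v → (∀ X → S X → X ⊆ v) → u ⊆ v)

    IsGlbIn : ∀ {t} → (DownSet → Set t) → DownSet → Set (suc lvl ⊔ ℓL ⊔ t)
    IsGlbIn S m = L m × (∀ X → S X → m ⊆ X)
                      × (∀ v → L v → (∀ X → S X → v ⊆ X) → v ⊆ m)

    IsMeetIn : DownSet → DownSet → DownSet → Set (suc lvl ⊔ ℓL)
    IsMeetIn x y m = L m × m ⊆ x × m ⊆ y
                       × (∀ w → L w → w ⊆ x → w ⊆ y → w ⊆ m)

    -- "x ∧_L y ≤ z" (the meet in L is unique, so any meet may be used)
    MeetBelow : DownSet → DownSet → DownSet → Set (suc lvl ⊔ ℓL)
    MeetBelow x y z = ∀ m → IsMeetIn x y m → m ⊆ z

    IsImpIn : DownSet → DownSet → DownSet → Set (suc lvl ⊔ ℓL)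
    IsImpIn x z h = L h × MeetBelow x h z
                      × (∀ y → L y → MeetBelow x y z → y ⊆ h)

    IsComplete : Set (suc (suc lvl ⊔ ℓL))
    IsComplete = (S : DownSet → Set (suc lvl ⊔ ℓL)) → (∀ X → S X → L X)
                 → Σ DownSet (IsLubIn S)

    record IsJoinCompletion : Set (suc (suc lvl ⊔ ℓL)) where
      field
        respects   : ∀ X Y → X ≐ Y → L X → L Y
        principal  : ∀ p → L (↓ p)
        complete   : IsComplete
        joinOfP    : ∀ X → L X → Σ (DownSet → Set lvl) λ S →
                       (∀ Y → S Y → ∃ λ p → Y ≐ ↓ p) × IsLubIn S X

    IsHeyting : Set (suc lvl ⊔ ℓL)
    IsHeyting = ∀ x z → L x → L z → Σ DownSet (IsImpIn x z)

    CondII : Set (c ⊔ suc lvl ⊔ ℓL)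
    CondII = ∀ a b → L b → L (↓ a ⇒ b)

    IsClosureIn : DownSet → DownSet → Set (suc lvl ⊔ ℓL)
    IsClosureIn X g = L g × X ⊆ g × (∀ c′ → L c′ → X ⊆ c′ → g ⊆ c′)

    IsClosureSystem : Set (suc lvl ⊔ ℓL)
    IsClosureSystem = ∀ X → Σ DownSet (IsClosureIn X)

    -- (iii) L is a nucleus-system of ⟨𝓛(P), ∩, ∪, ∩, →, P⟩
    -- (both residuals x\a and a/x equal x → a, as ∩ is commutative)
    IsNucleusSystem : Set (suc lvl ⊔ ℓL)
    IsNucleusSystem = IsClosureSystem × (∀ X a → L a → L (X ⇒ a))

    GammaIsNucleus : Set (suc lvl ⊔ ℓL)
    GammaIsNucleus = IsClosureSystem
                   × (∀ X Y gX gY gXY → IsClosureIn X gX → IsClosureIn Y gY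
                        → IsClosureIn (X ∩ Y) gXY → (gX ∩ gY) ⊆ gXY)

    HeytingUnique : Set (suc lvl ⊔ ℓL)
    HeytingUnique = ∀ x z h h′ → L x → L z → IsImpIn x z h → IsImpIn x z h′ → h ≐ h′

    PreservesMeets : (ℓS : Level) → Set (suc lvl ⊔ ℓL ⊔ suc ℓS)
    PreservesMeets ℓS = (S : Carrier → Set ℓS) (m : Carrier)
      → (∀ s → S s → m ≤ s) → (∀ y → (∀ s → S s → y ≤ s) → y ≤ m)
      → IsGlbIn (λ Y → ∃ λ s → S s × (Y ≐ ↓ s)) (↓ m)

    PreservesResiduals : Set (suc lvl ⊔ ℓL)
    PreservesResiduals = ∀ a b r → (a ∧ r) ≤ b → (∀ y → (a ∧ y) ≤ b → y ≤ r)
      → IsImpIn (↓ a) (↓ b) (↓ r)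

-- A join-completion L of P is closed under arbitrary intersections in 𝓛(P), so
-- its meets are intersections.  Since every element of 𝓛(P) is a union of
-- principal down-sets, a relative pseudocomplement x → z computed in L must then
-- coincide with x ⇒ z of 𝓛(P); hence L is Heyting exactly when it is closed
-- under ⇒, and closedness under ↓a ⇒ b already suffices because
-- X ⇒ b = ⋂_{w ∈ X} (↓w ⇒ b).  Closedness under ⇒ is equivalent to the nucleus
-- inequality γ X ∩ γ Y ⊆ γ (X ∩ Y) by the adjunction X ∩ Y ⊆ Z ⇔ Y ⊆ X ⇒ Z.
module Submission where

open import Defs hiding (_⊆_; _≐_; _∩_; _⇒_; ↓)
import Defs as 𝓓
open import Level using (Level; _⊔_; lift; lower)
open import Data.Product using (_×_; _,_; proj₁; proj₂)
open import Function.Bundles using (_⇔_; mk⇔)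
open import Relation.Binary.Lattice.Bundles using (BoundedMeetSemilattice)

module DownSets {c ℓ₁ ℓ₂ : Level} (P : BoundedMeetSemilattice c ℓ₁ ℓ₂) where
  open BoundedMeetSemilattice P

  infix  4 _⊆_ _≐_
  infixr 5 _⇒_
  infixr 6 _∩_

  _⊆_ _≐_ : DownSet P → DownSet P → Set (lvl P)
  _⊆_ = 𝓓._⊆_ P
  _≐_ = 𝓓._≐_ P

  _∩_ _⇒_ : DownSet P → DownSet P → DownSet P
  _∩_ = 𝓓._∩_ P
  _⇒_ = 𝓓._⇒_ P

  ↓ : Carrier → DownSet P
  ↓ = 𝓓.↓ P

  -- A down-set is not recoverable from its membership predicate, so lemmas about
  -- ⊆ often need their down-set arguments supplied explicitly.
  private variable
    X Y Z : DownSet P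

  ⊆-refl : X ⊆ X
  ⊆-refl x∈X = x∈X

  ⊆-trans : X ⊆ Y → Y ⊆ Z → X ⊆ Z
  ⊆-trans X⊆Y Y⊆Z x∈X = Y⊆Z (X⊆Y x∈X)

  ≐-refl : X ≐ X
  ≐-refl {X} = ⊆-refl {X} , ⊆-refl {X}

  ⇒-curry : X ∩ Y ⊆ Z → Y ⊆ X ⇒ Z
  ⇒-curry {Y = Y} X∩Y⊆Z y∈Y w≤y w∈X = X∩Y⊆Z (w∈X , down Y w≤y y∈Y)

  ⇒-uncurry : Y ⊆ X ⇒ Z → X ∩ Y ⊆ Z
  ⇒-uncurry Y⊆X⇒Z (x∈X , x∈Y) = Y⊆X⇒Z x∈Y refl x∈X

  ↓-⊆ : ∀ {x} → mem X x → ↓ x ⊆ X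
  ↓-⊆ {X = X} x∈X (lift y≤x) = down X y≤x x∈X

  ⇒-⊆-↓⇒ : ∀ {w} → mem X w → X ⇒ Z ⊆ ↓ w ⇒ Z
  ⇒-⊆-↓⇒ {X = X} w∈X h v≤u (lift v≤w) = h v≤u (down X v≤w w∈X)

  ↓-residual : ∀ {a b r} → a ∧ r ≤ b → (∀ y → a ∧ y ≤ b → y ≤ r) → ↓ r ≐ ↓ a ⇒ ↓ b
  ↓-residual {a} a∧r≤b greatest =
    (λ (lift z≤r) w≤z (lift w≤a) → lift (trans (∧-greatest w≤a (trans w≤z z≤r)) a∧r≤b)) ,
    (λ {z} h → lift (greatest z (lower (h (x∧y≤y a z) (lift (x∧y≤x a z))))))

module Subset {c ℓ₁ ℓ₂ ℓL : Level} (P : BoundedMeetSemilattice c ℓ₁ ℓ₂)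
  (L : DownSet P → Set ℓL) where
  open BoundedMeetSemilattice P
  open DownSets P

  isImpIn-unique : HeytingUnique P L
  isImpIn-unique _ _ _ _ _ _ (Lh , h-below , h-max) (Lh′ , h′-below , h′-max) =
    h′-max _ Lh h-below , h-max _ Lh′ h′-below

  ↓-preservesMeets : (∀ p → L (↓ p)) → ∀ ℓS → PreservesMeets P L ℓS
  ↓-preservesMeets principal ℓS S m m-lower m-greatest =
    principal m ,
    (λ X (s , Ss , _ , ↓s⊆X) (lift w≤m) → ↓s⊆X (lift (trans w≤m (m-lower s Ss)))) ,
    (λ v Lv v-lower {w} w∈v →
       lift (m-greatest w (λ s Ss → lower (v-lower (↓ s) (s , Ss , ≐-refl {↓ s}) w∈v))))

  ∩⊆⇒meetBelow : ∀ {x y z} → x ∩ y ⊆ z → MeetBelow P L x y z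
  ∩⊆⇒meetBelow x∩y⊆z m (_ , m⊆x , m⊆y , _) w∈m = x∩y⊆z (m⊆x w∈m , m⊆y w∈m)

module ClosureSystem {c ℓ₁ ℓ₂ ℓL : Level} (P : BoundedMeetSemilattice c ℓ₁ ℓ₂)
  (L : DownSet P → Set ℓL)
  (respects : ∀ X Y → 𝓓._≐_ P X Y → L X → L Y)
  (principal : ∀ p → L (𝓓.↓ P p))
  (closure : IsClosureSystem P L) where
  open BoundedMeetSemilattice P
  open DownSets P
  open Subset P L

  private variable
    X x y z h b : DownSet P

  γ : DownSet P → DownSet P
  γ X = proj₁ (closure X)

  γ-isClosure : IsClosureIn P L X (γ X)
  γ-isClosure {X} = proj₂ (closure X)

  γ-closed : L (γ X)
  γ-closed = proj₁ γ-isClosure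

  ⊆-γ : X ⊆ γ X
  ⊆-γ = proj₁ (proj₂ γ-isClosure)

  γ-least : ∀ {c′} → L c′ → X ⊆ c′ → γ X ⊆ c′
  γ-least Lc′ X⊆c′ = proj₂ (proj₂ γ-isClosure) _ Lc′ X⊆c′

  closed-if-γ⊆ : γ X ⊆ X → L X
  closed-if-γ⊆ γX⊆X = respects _ _ (γX⊆X , ⊆-γ) γ-closed

  ∩-closed : L x → L y → L (x ∩ y)
  ∩-closed {x} {y} Lx Ly = closed-if-γ⊆ λ w∈γ →
    γ-least {x ∩ y} Lx proj₁ w∈γ , γ-least {x ∩ y} Ly proj₂ w∈γ

  ∩-isMeetIn : L x → L y → IsMeetIn P L x y (x ∩ y)
  ∩-isMeetIn Lx Ly = ∩-closed Lx Ly , proj₁ , proj₂ , λ _ _ w⊆x w⊆y v∈w → w⊆x v∈w , w⊆y v∈w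

  meetBelow⇒∩⊆ : L x → L y → MeetBelow P L x y z → x ∩ y ⊆ z
  meetBelow⇒∩⊆ Lx Ly below = below _ (∩-isMeetIn Lx Ly)

  impIn-≐-⇒ : L x → IsImpIn P L x z h → h ≐ x ⇒ z
  impIn-≐-⇒ {x} {z} {h} Lx (Lh , h-below , h-max) =
    ⇒-curry {x} {h} {z} (meetBelow⇒∩⊆ {z = z} Lx Lh h-below) ,
    λ {u} u∈x⇒z → h-max (↓ u) (principal u)
      (∩⊆⇒meetBelow {x} {↓ u} {z} (⇒-uncurry {↓ u} {x} {z} (↓-⊆ {x ⇒ z} u∈x⇒z))) (lift refl)

  ≐-⇒-impIn : L x → L h → h ≐ x ⇒ z → IsImpIn P L x z h
  ≐-⇒-impIn {x} {h} {z} Lx Lh (h⊆x⇒z , x⇒z⊆h) =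
    Lh ,
    ∩⊆⇒meetBelow {x} {h} {z} (⇒-uncurry {h} {x} {z} h⊆x⇒z) ,
    λ y Ly below →
      ⊆-trans {y} {x ⇒ z} {h} (⇒-curry {x} {y} {z} (meetBelow⇒∩⊆ {x} {y} {z} Lx Ly below)) x⇒z⊆h

  heyting⇒condII : IsHeyting P L → CondII P L
  heyting⇒condII heyting a b Lb =
    let h , h-isImp = heyting (↓ a) b (principal a) Lb
    in respects h (↓ a ⇒ b) (impIn-≐-⇒ {↓ a} {b} {h} (principal a) h-isImp) (proj₁ h-isImp)

  condII⇒⇒-closed : CondII P L → ∀ X b → L b → L (X ⇒ b)
  condII⇒⇒-closed ii X b Lb = closed-if-γ⊆ {X ⇒ b} λ z∈γ {w} w≤z w∈X →
    γ-least {X ⇒ b} (ii w b Lb) (⇒-⊆-↓⇒ {X} {b} w∈X) z∈γ w≤z (lift refl)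

  condII⇒nucleusSystem : CondII P L → IsNucleusSystem P L
  condII⇒nucleusSystem ii = closure , condII⇒⇒-closed ii

  condII⇒heyting : CondII P L → IsHeyting P L
  condII⇒heyting ii x z Lx Lz =
    x ⇒ z , ≐-⇒-impIn {x} {x ⇒ z} {z} Lx (condII⇒⇒-closed ii x z Lz) (≐-refl {x ⇒ z})

  γ-∩-⊆ : (∀ X b → L b → L (X ⇒ b)) → ∀ X Y gX gY g → IsClosureIn P L X gX
    → IsClosureIn P L Y gY → IsClosureIn P L (X ∩ Y) g → gX ∩ gY ⊆ g
  γ-∩-⊆ ⇒-closed X Y gX gY g (_ , _ , gX-least) (_ , _ , gY-least) (Lg , X∩Y⊆g , _)
    (x∈gX , x∈gY) = gY⊆gX⇒g x∈gY refl x∈gX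
    where
    gX⊆Y⇒g : gX ⊆ Y ⇒ g
    gX⊆Y⇒g = gX-least (Y ⇒ g) (⇒-closed Y g Lg)
      λ x∈X w≤x w∈Y → X∩Y⊆g (down X w≤x x∈X , w∈Y)
    gY⊆gX⇒g : gY ⊆ gX ⇒ g
    gY⊆gX⇒g = gY-least (gX ⇒ g) (⇒-closed gX g Lg)
      λ y∈Y w≤y w∈gX → gX⊆Y⇒g w∈gX refl (down Y w≤y y∈Y)

  nucleusSystem⇒gammaIsNucleus : IsNucleusSystem P L → GammaIsNucleus P L
  nucleusSystem⇒gammaIsNucleus (_ , ⇒-closed) =
    closure , γ-∩-⊆ ⇒-closed

  gammaIsNucleus⇒nucleusSystem : GammaIsNucleus P L → IsNucleusSystem P L
  gammaIsNucleus⇒nucleusSystem (_ , nucleus) = closure , ⇒-closed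
    where
    ⇒-closed : ∀ X b → L b → L (X ⇒ b)
    ⇒-closed X b Lb = closed-if-γ⊆ {X ⇒ b} (⇒-curry {X = X} {Y = γ (X ⇒ b)} {Z = b} X∩γ⊆b)
      where
      X∩γ⊆b : X ∩ γ (X ⇒ b) ⊆ b
      X∩γ⊆b (x∈X , x∈γ) =
        γ-least {X ∩ (X ⇒ b)} Lb (⇒-uncurry {Y = X ⇒ b} {X = X} {Z = b} (⊆-refl {X ⇒ b}))
          (nucleus X (X ⇒ b) (γ X) (γ (X ⇒ b)) (γ (X ∩ (X ⇒ b)))
             γ-isClosure γ-isClosure γ-isClosure (⊆-γ {X} x∈X , x∈γ))

  ↓-preservesResiduals : PreservesResiduals P L
  ↓-preservesResiduals a b r a∧r≤b greatest =
    ≐-⇒-impIn {↓ a} {↓ r} {↓ b} (principal a) (principal r) (↓-residual a∧r≤b greatest)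

complete⇒closureSystem : ∀ {c ℓ₁ ℓ₂ ℓL} {P : BoundedMeetSemilattice c ℓ₁ ℓ₂}
  {L : DownSet P → Set ℓL} → (∀ p → L (𝓓.↓ P p)) → IsComplete P L → IsClosureSystem P L
complete⇒closureSystem {ℓL = ℓL} {P = P} {L} principal complete X =
  let g , Lg , g-upper , g-least = complete lowerBounds (λ _ → proj₁)
  in g , Lg ,
     (λ {x} x∈X → g-upper (↓ x) (principal x , λ c′ _ X⊆c′ → ↓-⊆ {c′} (X⊆c′ x∈X)) (lift refl)) ,
     λ c′ Lc′ X⊆c′ → g-least c′ Lc′ (λ _ (_ , below) → below c′ Lc′ X⊆c′)
  where
  open BoundedMeetSemilattice P
  open DownSets P
  -- γ X is the meet of the members of L above X, obtained as the join of their common lower bounds.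
  lowerBounds : DownSet P → Set (Level.suc (lvl P) ⊔ ℓL)
  lowerBounds Y = L Y × (∀ c′ → L c′ → X ⊆ c′ → Y ⊆ c′)

corollary3p7 : ∀ {c ℓ₁ ℓ₂ ℓL : Level} (ℓS : Level) (P : BoundedMeetSemilattice c ℓ₁ ℓ₂)
    (L : DownSet P → Set ℓL) → IsJoinCompletion P L
    → (IsHeyting P L ⇔ CondII P L) × (CondII P L ⇔ IsNucleusSystem P L)
      × (IsNucleusSystem P L ⇔ GammaIsNucleus P L)
      × (IsHeyting P L → HeytingUnique P L × PreservesMeets P L ℓS × PreservesResiduals P L)
corollary3p7 ℓS P L J =
  mk⇔ heyting⇒condII condII⇒heyting ,
  mk⇔ condII⇒nucleusSystem (λ (_ , ⇒-closed) a → ⇒-closed (↓ a)) ,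
  mk⇔ nucleusSystem⇒gammaIsNucleus gammaIsNucleus⇒nucleusSystem ,
  λ _ → isImpIn-unique , ↓-preservesMeets principal ℓS , ↓-preservesResiduals
  where
  open IsJoinCompletion J
  open DownSets P using (↓)
  open Subset P L
  open ClosureSystem P L respects principal (complete⇒closureSystem principal complete)
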